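{- Each of the following Weihrauch problems is strongly Weihrauch equivalent to the others: $\mathsf{P}$, $\widehat{\mathsf{P}}$, $\mathsf{D}$, $\widehat{\mathsf{D}}$, and $\widehat{\mathsf{LPO}}$.
   Context: A Weihrauch problem is a set $\mathsf{C}\subseteq 2^\omega\times 2^\omega$ of instance/solution pairs. $\mathsf{Q}\le_{\mathrm{sW}}\mathsf{R}$ means there are Turing functionals $\Phi,\Psi$ such that for every instance $A$ of $\mathsf{Q}$, $\Phi(A)$ is an instance of $\mathsf{R}$ and for every solution $T$ of $\Phi(A)$, $\Psi(T)$ is a solution of $A$; strong Weihrauch equivalence is reducibility both ways. For a problem $\mathsf{Q}$, its infinite parallelization $\widehat{\mathsf{Q}}$ has as instances sequences $\langle A_i\rangle_{i\in\mathbb{N}}$ of instances of $\mathsf{Q}$ and as solutions sequences $\langle B_i\rangle_{i\in\mathbb{N}}$ with each $B_i$ a solution to $A_i$. $\mathsf{P}$: instance a countable graph $(V,E)$ ($V$ nonempty infinite subset of $\mathbb{N}$), solution a connected component (a set of vertices any two joined by a finite path, closed under path connectedness). $\mathsf{D}$: instance a countable graph, solution a decomposition, i.e. a map $f\colon V\to\mathbb{N}$ with $f(v_0)=f(v_1)$ iff $v_0,v_1$ are in the same connected component. $\mathsf{LPO}$ (limited principle of omniscience): instance a function $p\colon\mathbb{N}\to\mathbb{N}$, solution the correct answer to whether there exists $n$ with $p(n)=0$ (equivalently, for $\widehat{\mathsf{LPO}}$, given $\langle p_i\rangle$ the solution is the set $\{i:\exists n\,p_i(n)=0\}$). -}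

module Defs where

open import Data.Nat using (ℕ; zero; suc; _+_; _*_; _≤_)
open import Data.Bool using (Bool; true; false)
open import Data.Fin using (Fin)
open import Data.Vec using (Vec; []; _∷_; lookup)
open import Data.Product using (Σ; ∃; _×_; _,_)
open import Data.Empty using (⊥)
open import Relation.Binary.PropositionalEquality using (_≡_)
open import Relation.Nullary using (¬_)
open import Function.Bundles using (_⇔_)

Cantor : Set
Cantor = ℕ → Bool

tri : ℕ → ℕ
tri zero    = 0
tri (suc n) = suc n + tri n

⟪_,_⟫ : ℕ → ℕ → ℕ
⟪ a , b ⟫ = tri (a + b) + b

column : Cantor → ℕ → Cantor
column X i n = X ⟪ i , n ⟫

bit : Bool → ℕ
bit true  = 1
bit false = 0

data Code : ℕ → Set where
  cz   : ∀ {k} → Code k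
  cs   : Code 1
  cp   : ∀ {k} → Fin k → Code k
  corc : Code 1
  ccmp : ∀ {k m} → Code m → Vec (Code k) m → Code k
  crec : ∀ {k} → Code k → Code (suc (suc k)) → Code (suc k)
  cmin : ∀ {k} → Code (suc k) → Code k

mutual
  data Eval (A : Cantor) : ∀ {k} → Code k → Vec ℕ k → ℕ → Set where
    ev-z    : ∀ {k} {xs : Vec ℕ k} → Eval A cz xs 0
    ev-s    : ∀ {x} → Eval A cs (x ∷ []) (suc x)
    ev-p    : ∀ {k} {i : Fin k} {xs} → Eval A (cp i) xs (lookup xs i)
    ev-orc  : ∀ {x} → Eval A corc (x ∷ []) (bit (A x))
    ev-cmp  : ∀ {k m} {f : Code m} {gs : Vec (Code k) m} {xs ys y} →
              EvalV A gs xs ys → Eval A f ys y → Eval A (ccmp f gs) xs y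
    ev-rec0 : ∀ {k} {f : Code k} {g} {xs y} →
              Eval A f xs y → Eval A (crec f g) (0 ∷ xs) y
    ev-recS : ∀ {k} {f : Code k} {g} {n xs z y} →
              Eval A (crec f g) (n ∷ xs) z → Eval A g (n ∷ z ∷ xs) y →
              Eval A (crec f g) (suc n ∷ xs) y
    ev-min  : ∀ {k} {f : Code (suc k)} {xs n} →
              MinFrom A f xs 0 n → Eval A (cmin f) xs n

  data EvalV (A : Cantor) {k : ℕ} : ∀ {m} → Vec (Code k) m → Vec ℕ k → Vec ℕ m → Set where
    evv-[] : ∀ {xs} → EvalV A [] xs []
    evv-∷  : ∀ {m} {g} {gs : Vec (Code k) m} {xs y ys} →
             Eval A g xs y → EvalV A gs xs ys → EvalV A (g ∷ gs) xs (y ∷ ys)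

  data MinFrom (A : Cantor) {k : ℕ} (f : Code (suc k)) (xs : Vec ℕ k) : ℕ → ℕ → Set where
    mf-here : ∀ {i} → Eval A f (i ∷ xs) 0 → MinFrom A f xs i i
    mf-next : ∀ {i m n} → Eval A f (i ∷ xs) (suc m) →
              MinFrom A f xs (suc i) n → MinFrom A f xs i n

Computes : Code 1 → Cantor → Cantor → Set
Computes e A B = ∀ n → Eval A e (n ∷ []) (bit (B n))

record Problem : Set₁ where
  field
    Inst : Cantor → Set
    Sol  : Cantor → Cantor → Set
open Problem public

_≤sW_ : Problem → Problem → Set
Q ≤sW R =
  Σ (Code 1) λ Φ → Σ (Code 1) λ Ψ →
    ∀ A → Inst Q A →
      Σ Cantor λ B → Computes Φ A B × Inst R B ×
        (∀ T → Sol R B T → Σ Cantor λ C → Computes Ψ T C × Sol Q A C)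

_≡sW_ : Problem → Problem → Set
Q ≡sW R = (Q ≤sW R) × (R ≤sW Q)

parallel : Problem → Problem
parallel Q = record
  { Inst = λ X → ∀ i → Inst Q (column X i)
  ; Sol  = λ X Y → ∀ i → Sol Q (column X i) (column Y i)
  }

Vert : Cantor → ℕ → Set
Vert X v = X (2 * v) ≡ true

Edge : Cantor → ℕ → ℕ → Set
Edge X a b = X (suc (2 * ⟪ a , b ⟫)) ≡ true

IsGraph : Cantor → Set
IsGraph X =
  (∀ n → ∃ λ v → n ≤ v × Vert X v)
  × (∀ a b → Edge X a b → Vert X a × Vert X b)
  × (∀ a b → Edge X a b → Edge X b a)
  × (∀ a → ¬ Edge X a a)

data Path (X : Cantor) : ℕ → ℕ → Set where
  p-nil  : ∀ {a} → Vert X a → Path X a a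
  p-cons : ∀ {a b c} → Edge X a b → Path X b c → Path X a c

IsComponent : Cantor → Cantor → Set
IsComponent X C =
  (∃ λ v → C v ≡ true)
  × (∀ v → C v ≡ true → Vert X v)
  × (∀ a b → C a ≡ true → C b ≡ true → Path X a b)
  × (∀ a b → C a ≡ true → Path X a b → C b ≡ true)

-- T codes (the graph of) a map f : V → ℕ, T ⟪v,n⟫ = true iff f(v) = n,
-- with f(v₀) = f(v₁) iff v₀, v₁ in the same component
IsDecomposition : Cantor → Cantor → Set
IsDecomposition X T =
  (∀ v n → T ⟪ v , n ⟫ ≡ true → Vert X v)
  × (∀ v → Vert X v → ∃ λ n → T ⟪ v , n ⟫ ≡ true)
  × (∀ v n m → T ⟪ v , n ⟫ ≡ true → T ⟪ v , m ⟫ ≡ true → n ≡ m)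
  × (∀ v₀ v₁ n₀ n₁ → T ⟪ v₀ , n₀ ⟫ ≡ true → T ⟪ v₁ , n₁ ⟫ ≡ true →
       (n₀ ≡ n₁ ⇔ Path X v₀ v₁))

P : Problem
P = record { Inst = IsGraph ; Sol = IsComponent }

D : Problem
D = record { Inst = IsGraph ; Sol = IsDecomposition }

-- LPO.  An instance p : ℕ → ℕ is coded by its graph:
--   X ⟪n,m⟫ = true iff p(n) = m.
-- The solution (the yes/no answer) is coded as the constant sequence
-- with value true iff ∃ n. p(n) = 0.

LPO : Problem
LPO = record
  { Inst = λ X → Σ (ℕ → ℕ) λ p → ∀ n m → (X ⟪ n , m ⟫ ≡ true ⇔ p n ≡ m)
  ; Sol  = λ X T → ∀ k → (T k ≡ true ⇔ ∃ λ n → X ⟪ n , 0 ⟫ ≡ true)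
  }

-- Given parallel-LPO instances p₀, p₁, …, build one graph on ℕ in which every vertex v carries, for each j, a
-- path v — ⟨v,j,1⟩ — ⟨v,j,2⟩ — ⋯ and an edge from ⟨v,j,0⟩ to ⟨v,j,k+1⟩ for the least zero k of p_j. Its edge
-- relation is decidable, and v is connected to ⟨v,j,0⟩ iff p_j has a zero; hence one connected component, or a
-- decomposition compared at vertex 0, answers every p_j. Conversely, connectedness of two vertices is a Σ⁰₁
-- question (is there a code of a walk between them?), so a single parallel-LPO instance answers it for all graphs
-- and all pairs at once; graph i then receives the component of its least vertex, or the decomposition labelling
-- each vertex by the least vertex connected to it. As every problem reduces to its parallelization, this closes
-- all the cycles.

module Submission where

open import Defs
open import Data.Nat hiding (parity)
open import Data.Nat.Properties
open import Data.Bool using (Bool; true; false)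
import Data.Bool as Bool
open import Data.Fin using (Fin; zero; suc; #_)
open import Data.Vec using (Vec; []; _∷_; lookup; tabulate)
open import Data.Vec.Properties using (tabulate∘lookup)
open import Data.Product using (Σ; ∃; _×_; _,_; proj₁; proj₂)
open import Data.Sum using (_⊎_; inj₁; inj₂; [_,_]′; swap)
open import Data.Empty using (⊥; ⊥-elim)
open import Relation.Binary.PropositionalEquality
open import Relation.Nullary using (¬_; Dec; yes; no)
open import Relation.Binary.Definitions using (tri<; tri≈; tri>)
open import Function using (_∘_)
open import Function.Bundles using (_⇔_; mk⇔; Equivalence)
open import Function.Properties.Equivalence using () renaming (trans to ⇔-trans)

-- Computable expressions

data Exp (k : ℕ) : Set where
  `v    : Fin k → Exp k
  `n    : ℕ → Exp k
  _`+_  : Exp k → Exp k → Exp k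
  _`∸_  : Exp k → Exp k → Exp k
  `ifz  : Exp k → Exp k → Exp k → Exp k
  `orc  : Exp k → Exp k
  `rec  : Exp k → Exp k → Exp (suc (suc k)) → Exp k

ifz : ℕ → ℕ → ℕ → ℕ
ifz zero    a b = a
ifz (suc _) a b = b

primRec : ℕ → (ℕ → ℕ → ℕ) → ℕ → ℕ
primRec b s zero    = b
primRec b s (suc n) = s n (primRec b s n)

⟦_⟧ : ∀ {k} → Exp k → Cantor → Vec ℕ k → ℕ
⟦ `v i ⟧        A xs = lookup xs i
⟦ `n n ⟧        A xs = n
⟦ e `+ f ⟧      A xs = ⟦ e ⟧ A xs + ⟦ f ⟧ A xs
⟦ e `∸ f ⟧      A xs = ⟦ e ⟧ A xs ∸ ⟦ f ⟧ A xs
⟦ `ifz c a b ⟧  A xs = ifz (⟦ c ⟧ A xs) (⟦ a ⟧ A xs) (⟦ b ⟧ A xs)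
⟦ `orc e ⟧      A xs = bit (A (⟦ e ⟧ A xs))
⟦ `rec n b s ⟧  A xs = primRec (⟦ b ⟧ A xs) (λ i z → ⟦ s ⟧ A (i ∷ z ∷ xs)) (⟦ n ⟧ A xs)

constCode : ∀ {k} → ℕ → Code k
constCode zero    = cz
constCode (suc n) = ccmp cs (constCode n ∷ [])

addCode : Code 2
addCode = crec (cp zero) (ccmp cs (cp (suc zero) ∷ []))

predCode : Code 1
predCode = crec cz (cp zero)

-- arguments in the order (y , x), computing x ∸ y by recursion on y
monusCode : Code 2
monusCode = crec (cp zero) (ccmp predCode (cp (suc zero) ∷ []))

ifzCode : Code 3
ifzCode = crec (cp zero) (cp (suc (suc (suc zero))))

compile : ∀ {k} → Exp k → Code k
compile (`v i)        = cp i
compile (`n n)        = constCode n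
compile (e `+ f)      = ccmp addCode (compile e ∷ compile f ∷ [])
compile (e `∸ f)      = ccmp monusCode (compile f ∷ compile e ∷ [])
compile (`ifz c a b)  = ccmp ifzCode (compile c ∷ compile a ∷ compile b ∷ [])
compile (`orc e)      = ccmp corc (compile e ∷ [])
compile (`rec n b s)  = ccmp (crec (compile b) (compile s)) (compile n ∷ tabulate cp)

module _ (A : Cantor) where

  eval-constCode : ∀ {k} n (xs : Vec ℕ k) → Eval A (constCode n) xs n
  eval-constCode zero    xs = ev-z
  eval-constCode (suc n) xs = ev-cmp (evv-∷ (eval-constCode n xs) evv-[]) ev-s

  eval-addCode : ∀ x y → Eval A addCode (x ∷ y ∷ []) (x + y)
  eval-addCode zero    y = ev-rec0 ev-p
  eval-addCode (suc x) y = ev-recS (eval-addCode x y) (ev-cmp (evv-∷ ev-p evv-[]) ev-s)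

  eval-predCode : ∀ x → Eval A predCode (x ∷ []) (pred x)
  eval-predCode zero    = ev-rec0 ev-z
  eval-predCode (suc x) = ev-recS (eval-predCode x) ev-p

  eval-monusCode : ∀ y x → Eval A monusCode (y ∷ x ∷ []) (x ∸ y)
  eval-monusCode zero    x = ev-rec0 ev-p
  eval-monusCode (suc y) x = subst (Eval A monusCode (suc y ∷ x ∷ [])) (pred[m∸n]≡m∸[1+n] x y)
    (ev-recS (eval-monusCode y x) (ev-cmp (evv-∷ ev-p evv-[]) (eval-predCode (x ∸ y))))

  eval-ifzCode : ∀ c a b → Eval A ifzCode (c ∷ a ∷ b ∷ []) (ifz c a b)
  eval-ifzCode zero    a b = ev-rec0 ev-p
  eval-ifzCode (suc c) a b = ev-recS (eval-ifzCode c a b) ev-p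

  eval-crec : ∀ {k} {f : Code k} {g : Code (suc (suc k))} {xs b} {s : ℕ → ℕ → ℕ} →
              Eval A f xs b → (∀ i z → Eval A g (i ∷ z ∷ xs) (s i z)) →
              ∀ n → Eval A (crec f g) (n ∷ xs) (primRec b s n)
  eval-crec hf hg zero    = ev-rec0 hf
  eval-crec hf hg (suc n) = ev-recS (eval-crec hf hg n) (hg n _)

  eval-projections : ∀ {k m} (f : Fin m → Fin k) (xs : Vec ℕ k) →
                     EvalV A (tabulate (λ i → cp (f i))) xs (tabulate (λ i → lookup xs (f i)))
  eval-projections {m = zero}  f xs = evv-[]
  eval-projections {m = suc m} f xs = evv-∷ ev-p (eval-projections (λ i → f (suc i)) xs)

  eval-compile : ∀ {k} (e : Exp k) (xs : Vec ℕ k) → Eval A (compile e) xs (⟦ e ⟧ A xs)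
  eval-compile (`v i)       xs = ev-p
  eval-compile (`n n)       xs = eval-constCode n xs
  eval-compile (e `+ f)     xs =
    ev-cmp (evv-∷ (eval-compile e xs) (evv-∷ (eval-compile f xs) evv-[])) (eval-addCode _ _)
  eval-compile (e `∸ f)     xs =
    ev-cmp (evv-∷ (eval-compile f xs) (evv-∷ (eval-compile e xs) evv-[])) (eval-monusCode _ _)
  eval-compile (`ifz c a b) xs =
    ev-cmp (evv-∷ (eval-compile c xs) (evv-∷ (eval-compile a xs) (evv-∷ (eval-compile b xs) evv-[])))
           (eval-ifzCode _ _ _)
  eval-compile (`orc e)     xs = ev-cmp (evv-∷ (eval-compile e xs) evv-[]) ev-orc
  eval-compile (`rec n b s) xs =
    ev-cmp (evv-∷ (eval-compile n xs)
                  (subst (EvalV A (tabulate cp) xs) (tabulate∘lookup xs) (eval-projections (λ i → i) xs)))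
           (eval-crec (eval-compile b xs) (λ i z → eval-compile s (i ∷ z ∷ xs)) _)

-- Least witnesses and unbounded search

∀<-extend : ∀ {P : ℕ → Set} {n} → (∀ l → l < n → P l) → P n → ∀ l → l < suc n → P l
∀<-extend below pn l l<1+n with m≤n⇒m<n∨m≡n (m<1+n⇒m≤n l<1+n)
... | inj₁ l<n  = below l l<n
... | inj₂ refl = pn

Least : (ℕ → Set) → ℕ → Set
Least Q n = Q n × (∀ j → j < n → ¬ Q j)

Least-search : ∀ {Q : ℕ → Set} → (∀ n → Dec (Q n)) → ∀ n → (∀ l → l < n → ¬ Q l) ⊎ ∃ (Least Q)
Least-search Q? zero = inj₁ (λ l ())
Least-search Q? (suc n) with Least-search Q? n
... | inj₂ least = inj₂ least
... | inj₁ below with Q? n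
...   | yes qn  = inj₂ (n , qn , below)
...   | no  ¬qn = inj₁ (∀<-extend below ¬qn)

Least-exists : ∀ {Q : ℕ → Set} → (∀ n → Dec (Q n)) → ∀ {n} → Q n → ∃ (Least Q)
Least-exists Q? {n} qn with Least-search Q? (suc n)
... | inj₁ below = ⊥-elim (below n ≤-refl qn)
... | inj₂ least = least

Least-map : ∀ {Q₀ Q₁ : ℕ → Set} {n} → (∀ u → Q₀ u ⇔ Q₁ u) → Least Q₀ n → Least Q₁ n
Least-map Q₀⇔Q₁ (qn , below) =
  Equivalence.to (Q₀⇔Q₁ _) qn , λ j j<n q₁ → below j j<n (Equivalence.from (Q₀⇔Q₁ j) q₁)

Least-unique : ∀ {Q₀ Q₁ : ℕ → Set} {m n} → (∀ u → Q₀ u → Q₁ u) → (∀ u → Q₁ u → Q₀ u) →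
               Least Q₀ m → Least Q₁ n → m ≡ n
Least-unique {m = m} {n} f g (qm , below-m) (qn , below-n) with <-cmp m n
... | tri< m<n _ _ = ⊥-elim (below-n m m<n (f m qm))
... | tri≈ _ m≡n _ = m≡n
... | tri> _ _ n<m = ⊥-elim (below-m n n<m (g n qn))

module _ (A : Cantor) {k} (f : Code (suc k)) (xs : Vec ℕ k) (g : ℕ → ℕ)
         (eval-f : ∀ j → Eval A f (j ∷ xs) (g j)) where

  -- d bounds the number of steps until a zero of g is reached
  search-from : ∀ i d → g (d + i) ≡ 0 →
                ∃ λ n → MinFrom A f xs i n × g n ≡ 0 × (∀ j → i ≤ j → j < n → g j ≢ 0)
  search-from i d gz with g i in gi
  ... | zero = i , mf-here (subst (Eval A f (i ∷ xs)) gi (eval-f i)) , gi ,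
               λ j i≤j j<i → ⊥-elim (<-irrefl refl (≤-<-trans i≤j j<i))
  search-from i zero gz | suc _ = ⊥-elim (1+n≢0 (trans (sym gi) gz))
  search-from i (suc d) gz | suc _ with search-from (suc i) d (subst (λ t → g t ≡ 0) (sym (+-suc d i)) gz)
  ... | n , mf , gn , above = n , mf-next (subst (Eval A f (i ∷ xs)) gi (eval-f i)) mf , gn , above′
    where
    above′ : ∀ j → i ≤ j → j < n → g j ≢ 0
    above′ j i≤j j<n with m≤n⇒m<n∨m≡n i≤j
    ... | inj₁ i<j  = above j i<j j<n
    ... | inj₂ refl = λ gj → 1+n≢0 (trans (sym gi) gj)

  eval-cmin : (∃ λ j → g j ≡ 0) → ∃ λ n → Eval A (cmin f) xs n × Least (λ j → g j ≡ 0) n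
  eval-cmin (j , gj) with search-from 0 j (subst (λ t → g t ≡ 0) (sym (+-identityʳ j)) gj)
  ... | n , mf , gn , above = n , ev-min mf , gn , λ j′ → above j′ z≤n

-- Composing Turing functionals

mutual
  substOracle : ∀ {k} → Code k → Code 1 → Code k
  substOracle cz          Φ = cz
  substOracle cs          Φ = cs
  substOracle (cp i)      Φ = cp i
  substOracle corc        Φ = Φ
  substOracle (ccmp f gs) Φ = ccmp (substOracle f Φ) (substOracleⱽ gs Φ)
  substOracle (crec f g)  Φ = crec (substOracle f Φ) (substOracle g Φ)
  substOracle (cmin f)    Φ = cmin (substOracle f Φ)

  substOracleⱽ : ∀ {k m} → Vec (Code k) m → Code 1 → Vec (Code k) m
  substOracleⱽ []       Φ = []
  substOracleⱽ (g ∷ gs) Φ = substOracle g Φ ∷ substOracleⱽ gs Φ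

module _ {Φ : Code 1} {A B : Cantor} (Φ-computes : Computes Φ A B) where
  mutual
    eval-substOracle : ∀ {k} {c : Code k} {xs y} → Eval B c xs y → Eval A (substOracle c Φ) xs y
    eval-substOracle ev-z            = ev-z
    eval-substOracle ev-s            = ev-s
    eval-substOracle ev-p            = ev-p
    eval-substOracle (ev-orc {x})    = Φ-computes x
    eval-substOracle (ev-cmp hs h)   = ev-cmp (evalV-substOracle hs) (eval-substOracle h)
    eval-substOracle (ev-rec0 h)     = ev-rec0 (eval-substOracle h)
    eval-substOracle (ev-recS h h′)  = ev-recS (eval-substOracle h) (eval-substOracle h′)
    eval-substOracle (ev-min m)      = ev-min (minFrom-substOracle m)

    evalV-substOracle : ∀ {k m} {gs : Vec (Code k) m} {xs ys} →
                        EvalV B gs xs ys → EvalV A (substOracleⱽ gs Φ) xs ys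
    evalV-substOracle evv-[]       = evv-[]
    evalV-substOracle (evv-∷ h hs) = evv-∷ (eval-substOracle h) (evalV-substOracle hs)

    minFrom-substOracle : ∀ {k} {f : Code (suc k)} {xs i n} →
                          MinFrom B f xs i n → MinFrom A (substOracle f Φ) xs i n
    minFrom-substOracle (mf-here h)   = mf-here (eval-substOracle h)
    minFrom-substOracle (mf-next h m) = mf-next (eval-substOracle h) (minFrom-substOracle m)

Computes-∘ : ∀ {Φ Ψ A B C} → Computes Φ A B → Computes Ψ B C → Computes (substOracle Ψ Φ) A C
Computes-∘ hΦ hΨ n = eval-substOracle hΦ (hΨ n)

≤sW-trans : ∀ {Q R S} → Q ≤sW R → R ≤sW S → Q ≤sW S
≤sW-trans (Φ₁ , Ψ₁ , red₁) (Φ₂ , Ψ₂ , red₂) = substOracle Φ₂ Φ₁ , substOracle Ψ₁ Ψ₂ , λ A iA →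
  let (B , cB , iB , back₁) = red₁ A iA
      (C , cC , iC , back₂) = red₂ B iB
  in C , Computes-∘ cB cC , iC , λ T sT →
       let (D , cD , sD) = back₂ T sT
           (E , cE , sE) = back₁ D sD
       in E , Computes-∘ cD cE , sE

data Reflectsᴺ (P : Set) : ℕ → Set where
  ofʸ : P → Reflectsᴺ P 1
  ofⁿ : ¬ P → Reflectsᴺ P 0

Reflectsᴺ-map : ∀ {P Q n} → (P → Q) → (Q → P) → Reflectsᴺ P n → Reflectsᴺ Q n
Reflectsᴺ-map f g (ofʸ p)  = ofʸ (f p)
Reflectsᴺ-map f g (ofⁿ ¬p) = ofⁿ (λ q → ¬p (g q))

-- Each expression builder `op comes with a function opᴺ (or op′) on ℕ to which its denotation reduces
-- definitionally; the reflection lemmas are stated for the latter.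
_≡ᴺ_ _≤ᴺ_ _∧ᴺ_ _∨ᴺ_ : ℕ → ℕ → ℕ
x ≡ᴺ y = ifz (x ∸ y) (ifz (y ∸ x) 1 0) 0
x ≤ᴺ y = ifz (x ∸ y) 1 0
a ∧ᴺ b = ifz a 0 b
a ∨ᴺ b = ifz a b 1

¬ᴺ_ : ℕ → ℕ
¬ᴺ a = ifz a 1 0

_`≡_ _`≤_ _`∧_ _`∨_ : ∀ {k} → Exp k → Exp k → Exp k
x `≡ y = `ifz (x `∸ y) (`ifz (y `∸ x) (`n 1) (`n 0)) (`n 0)
x `≤ y = `ifz (x `∸ y) (`n 1) (`n 0)
a `∧ b = `ifz a (`n 0) b
a `∨ b = `ifz a b (`n 1)

`¬_ : ∀ {k} → Exp k → Exp k
`¬ a = `ifz a (`n 1) (`n 0)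

infix  4 _≡ᴺ_ _≤ᴺ_ _`≡_ _`≤_
infixr 3 _∧ᴺ_ _`∧_
infixr 2 _∨ᴺ_ _`∨_
infix  5 ¬ᴺ_ `¬_

≤ᴺ-reflects : ∀ x y → Reflectsᴺ (x ≤ y) (x ≤ᴺ y)
≤ᴺ-reflects x y with x ∸ y in x∸y
... | zero  = ofʸ (m∸n≡0⇒m≤n x∸y)
... | suc _ = ofⁿ (λ x≤y → 0≢1+n (trans (sym (m≤n⇒m∸n≡0 x≤y)) x∸y))

≡ᴺ-reflects : ∀ x y → Reflectsᴺ (x ≡ y) (x ≡ᴺ y)
≡ᴺ-reflects x y with x ∸ y in x∸y | y ∸ x in y∸x
... | zero  | zero  = ofʸ (≤-antisym (m∸n≡0⇒m≤n x∸y) (m∸n≡0⇒m≤n y∸x))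
... | zero  | suc _ = ofⁿ (λ { refl → 0≢1+n (trans (sym (n∸n≡0 x)) y∸x) })
... | suc _ | _     = ofⁿ (λ { refl → 0≢1+n (trans (sym (n∸n≡0 x)) x∸y) })

∧ᴺ-reflects : ∀ {P Q a b} → Reflectsᴺ P a → Reflectsᴺ Q b → Reflectsᴺ (P × Q) (a ∧ᴺ b)
∧ᴺ-reflects (ofⁿ ¬p) _        = ofⁿ (λ pq → ¬p (proj₁ pq))
∧ᴺ-reflects (ofʸ p)  (ofʸ q)  = ofʸ (p , q)
∧ᴺ-reflects (ofʸ p)  (ofⁿ ¬q) = ofⁿ (λ pq → ¬q (proj₂ pq))

∨ᴺ-reflects : ∀ {P Q a b} → Reflectsᴺ P a → Reflectsᴺ Q b → Reflectsᴺ (P ⊎ Q) (a ∨ᴺ b)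
∨ᴺ-reflects (ofʸ p)  _        = ofʸ (inj₁ p)
∨ᴺ-reflects (ofⁿ ¬p) (ofʸ q)  = ofʸ (inj₂ q)
∨ᴺ-reflects (ofⁿ ¬p) (ofⁿ ¬q) = ofⁿ (λ { (inj₁ p) → ¬p p ; (inj₂ q) → ¬q q })

¬ᴺ-reflects : ∀ {P a} → Reflectsᴺ P a → Reflectsᴺ (¬ P) (¬ᴺ a)
¬ᴺ-reflects (ofʸ p)  = ofⁿ (λ ¬p → ¬p p)
¬ᴺ-reflects (ofⁿ ¬p) = ofʸ ¬p

¬ᴺ≡0⇔ : ∀ {P n} → Reflectsᴺ P n → ¬ᴺ n ≡ 0 ⇔ P
¬ᴺ≡0⇔ (ofʸ p)  = mk⇔ (λ _ → p) (λ _ → refl)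
¬ᴺ≡0⇔ (ofⁿ ¬p) = mk⇔ (λ ()) (λ p → ⊥-elim (¬p p))

bit-reflects : ∀ (X : Cantor) {m n} → m ≡ n → Reflectsᴺ (X n ≡ true) (bit (X m))
bit-reflects X {m} refl with X m
... | true  = ofʸ refl
... | false = ofⁿ (λ ())

∀<ᴺ : (ℕ → ℕ) → ℕ → ℕ
∀<ᴺ f = primRec 1 (λ l acc → acc ∧ᴺ f l)

`∀< : ∀ {k} → Exp k → Exp (suc (suc k)) → Exp k
`∀< n body = `rec n (`n 1) (`v (# 1) `∧ body)

∀<ᴺ-reflects : ∀ {P : ℕ → Set} (f : ℕ → ℕ) → (∀ l → Reflectsᴺ (P l) (f l)) →
               ∀ n → Reflectsᴺ (∀ l → l < n → P l) (∀<ᴺ f n)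
∀<ᴺ-reflects f r zero    = ofʸ (λ l ())
∀<ᴺ-reflects f r (suc n) = Reflectsᴺ-map
  (λ (below , pn) → ∀<-extend below pn)
  (λ all → (λ l l<n → all l (m<n⇒m<1+n l<n)) , all n ≤-refl)
  (∧ᴺ-reflects (∀<ᴺ-reflects f r n) (r n))

-- r stays put once it has dropped below u, i.e. once a witness below u has been found
`firstBelow : ∀ {k} → Exp k → Exp (suc (suc k)) → Exp k
`firstBelow n body = `rec n (`n 0) (`ifz (`v (# 1) `≡ `v (# 0)) (`v (# 1)) (`ifz body (`n 1 `+ `v (# 0)) (`v (# 0))))

firstBelow : (ℕ → ℕ) → ℕ → ℕ
firstBelow f = primRec 0 (λ u r → ifz (r ≡ᴺ u) r (ifz (f u) (suc u) u))

module _ {P : ℕ → Set} (f : ℕ → ℕ) (f-reflects : ∀ u → Reflectsᴺ (P u) (f u)) where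

  FirstBelow : ℕ → ℕ → Set
  FirstBelow n r = r ≤ n × (r < n → P r) × (∀ u → u < r → ¬ P u)

  firstBelow-spec : ∀ n → FirstBelow n (firstBelow f n)
  firstBelow-spec zero    = z≤n , (λ ()) , (λ u ())
  firstBelow-spec (suc n) = step (firstBelow f n) (firstBelow-spec n)
    where
    step : ∀ r → FirstBelow n r → FirstBelow (suc n) (ifz (r ≡ᴺ n) r (ifz (f n) (suc n) n))
    step r (r≤n , found , below) with r ≡ᴺ n | ≡ᴺ-reflects r n
    ... | .0 | ofⁿ r≢n = m≤n⇒m≤1+n r≤n , (λ _ → found (≤∧≢⇒< r≤n r≢n)) , below
    ... | .1 | ofʸ refl with f r | f-reflects r
    ...   | .1 | ofʸ pr  = n≤1+n r , (λ _ → pr) , below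
    ...   | .0 | ofⁿ ¬pr = ≤-refl , (λ r<r → ⊥-elim (<-irrefl refl r<r)) , ∀<-extend below ¬pr

  firstBelow-least : ∀ {v} → P v → Least P (firstBelow f (suc v))
  firstBelow-least {v} pv with firstBelow-spec (suc v)
  ... | r≤1+v , found , below with m≤n⇒m<n∨m≡n r≤1+v
  ...   | inj₁ r<1+v = found r<1+v , below
  ...   | inj₂ r≡1+v = ⊥-elim (below v (subst (v <_) (sym r≡1+v) ≤-refl) pv)

-- Computable inverse of the pairing function

`tri : ∀ {k} → Exp k → Exp k
`tri e = `rec e (`n 0) ((`n 1 `+ `v (# 0)) `+ `v (# 1))

tri′ : ℕ → ℕ
tri′ = primRec 0 (λ i t → suc i + t)

tri′≡tri : ∀ n → tri′ n ≡ tri n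
tri′≡tri zero    = refl
tri′≡tri (suc n) = cong (suc n +_) (tri′≡tri n)

`pair : ∀ {k} → Exp k → Exp k → Exp k
`pair a b = `tri (a `+ b) `+ b

pair′ : ℕ → ℕ → ℕ
pair′ a b = tri′ (a + b) + b

pair′≡pair : ∀ a b → pair′ a b ≡ ⟪ a , b ⟫
pair′≡pair a b = cong (_+ b) (tri′≡tri (a + b))

tri-mono-≤ : ∀ {m n} → m ≤ n → tri m ≤ tri n
tri-mono-≤ {zero}  _         = z≤n
tri-mono-≤ {suc m} (s≤s m≤n) = +-mono-≤ (s≤s m≤n) (tri-mono-≤ m≤n)

n≤tri : ∀ n → n ≤ tri n
n≤tri zero    = z≤n
n≤tri (suc n) = m≤m+n (suc n) (tri n)

-- counting up along z, d moves to the next diagonal as soon as z reaches tri (suc d)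
`diagonal : ∀ {k} → Exp k → Exp k
`diagonal z = `rec z (`n 0)
  (`ifz (`tri (`n 1 `+ `v (# 1)) `∸ (`n 1 `+ `v (# 0))) (`n 1 `+ `v (# 1)) (`v (# 1)))

diagonal : ℕ → ℕ
diagonal = primRec 0 (λ i d → ifz (tri′ (suc d) ∸ suc i) (suc d) d)

OnDiagonal : ℕ → ℕ → Set
OnDiagonal d z = tri d ≤ z × z < tri (suc d)

OnDiagonal-diagonal : ∀ z → OnDiagonal (diagonal z) z
OnDiagonal-diagonal zero = z≤n , s≤s z≤n
OnDiagonal-diagonal (suc i) with OnDiagonal-diagonal i | tri′ (suc (diagonal i)) ∸ suc i in eq
... | _ , hi | zero =
  subst (_≤ suc i) (tri′≡tri (suc (diagonal i))) (m∸n≡0⇒m≤n eq) ,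
  <-≤-trans (s≤s hi) (m<n+m (tri (suc (diagonal i))) {suc (suc (diagonal i))} z<s)
... | lo , _ | suc _ =
  m≤n⇒m≤1+n lo ,
  subst (suc i <_) (tri′≡tri (suc (diagonal i))) (≰⇒> (λ le → 0≢1+n (trans (sym (m≤n⇒m∸n≡0 le)) eq)))

OnDiagonal-unique : ∀ {d e z} → OnDiagonal d z → OnDiagonal e z → d ≡ e
OnDiagonal-unique {d} {e} (lo-d , hi-d) (lo-e , hi-e) with <-cmp d e
... | tri< d<e _ _ = ⊥-elim (<-irrefl refl (<-≤-trans hi-d (≤-trans (tri-mono-≤ d<e) lo-e)))
... | tri≈ _ d≡e _ = d≡e
... | tri> _ _ e<d = ⊥-elim (<-irrefl refl (<-≤-trans hi-e (≤-trans (tri-mono-≤ e<d) lo-d)))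

OnDiagonal-pair : ∀ a b → OnDiagonal (a + b) ⟪ a , b ⟫
OnDiagonal-pair a b =
  m≤m+n (tri (a + b)) b ,
  subst (⟪ a , b ⟫ <_) (+-comm (tri (a + b)) (suc (a + b))) (+-monoʳ-< (tri (a + b)) (s≤s (m≤n+m b a)))

`unpair₁ `unpair₂ : ∀ {k} → Exp k → Exp k
`unpair₂ z = z `∸ `tri (`diagonal z)
`unpair₁ z = `diagonal z `∸ `unpair₂ z

unpair₁ unpair₂ : ℕ → ℕ
unpair₂ z = z ∸ tri′ (diagonal z)
unpair₁ z = diagonal z ∸ unpair₂ z

diagonal-pair : ∀ a b → diagonal ⟪ a , b ⟫ ≡ a + b
diagonal-pair a b = OnDiagonal-unique (OnDiagonal-diagonal ⟪ a , b ⟫) (OnDiagonal-pair a b)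

unpair₂-pair : ∀ a b → unpair₂ ⟪ a , b ⟫ ≡ b
unpair₂-pair a b = begin
  ⟪ a , b ⟫ ∸ tri′ (diagonal ⟪ a , b ⟫) ≡⟨ cong (λ d → ⟪ a , b ⟫ ∸ tri′ d) (diagonal-pair a b) ⟩
  ⟪ a , b ⟫ ∸ tri′ (a + b)              ≡⟨ cong (⟪ a , b ⟫ ∸_) (tri′≡tri (a + b)) ⟩
  tri (a + b) + b ∸ tri (a + b)         ≡⟨ m+n∸m≡n (tri (a + b)) b ⟩
  b                                     ∎
  where open ≡-Reasoning

unpair₁-pair : ∀ a b → unpair₁ ⟪ a , b ⟫ ≡ a
unpair₁-pair a b = trans (cong₂ _∸_ (diagonal-pair a b) (unpair₂-pair a b)) (m+n∸n≡m a b)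

pair-injective : ∀ {a b c d} → ⟪ a , b ⟫ ≡ ⟪ c , d ⟫ → a ≡ c × b ≡ d
pair-injective {a} {b} {c} {d} e =
  trans (sym (unpair₁-pair a b)) (trans (cong unpair₁ e) (unpair₁-pair c d)) ,
  trans (sym (unpair₂-pair a b)) (trans (cong unpair₂ e) (unpair₂-pair c d))

pair-unpair : ∀ z → ⟪ unpair₁ z , unpair₂ z ⟫ ≡ z
pair-unpair z = begin
  tri (d ∸ s + s) + s ≡⟨ cong (λ u → tri u + s) (m∸n+n≡m s≤d) ⟩
  tri d + s           ≡⟨ cong (tri d +_) s≡ ⟩
  tri d + (z ∸ tri d) ≡⟨ m+[n∸m]≡n tri≤z ⟩
  z                   ∎
  where
  open ≡-Reasoning
  d = diagonal z
  s = unpair₂ z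
  tri≤z : tri d ≤ z
  tri≤z = proj₁ (OnDiagonal-diagonal z)
  s≡ : s ≡ z ∸ tri d
  s≡ = cong (z ∸_) (tri′≡tri d)
  s≤d : s ≤ d
  s≤d = m<1+n⇒m≤n (subst₂ _<_ (sym s≡) (m+n∸n≡m (suc d) (tri d))
                              (∸-monoˡ-< (proj₂ (OnDiagonal-diagonal z)) tri≤z))

m≤pair : ∀ a b → a ≤ ⟪ a , b ⟫
m≤pair a b = ≤-trans (m≤m+n a b) (≤-trans (n≤tri (a + b)) (m≤m+n _ b))

pair-monoʳ-< : ∀ a {b c} → b < c → ⟪ a , b ⟫ < ⟪ a , c ⟫
pair-monoʳ-< a b<c = +-mono-≤-< (tri-mono-≤ (+-monoʳ-≤ a (<⇒≤ b<c))) b<c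

2*n≡n+n : ∀ n → 2 * n ≡ n + n
2*n≡n+n n = cong (n +_) (+-identityʳ n)

`parity `half : ∀ {k} → Exp k → Exp k
`parity z = `rec z (`n 0) (`n 1 `∸ `v (# 1))
`half z   = `rec z (`n 0) (`v (# 1) `+ `parity (`v (# 0)))

parity half : ℕ → ℕ
parity = primRec 0 (λ _ p → 1 ∸ p)
half   = primRec 0 (λ i h → h + parity i)

parity-even : ∀ v → parity (v + v) ≡ 0
parity-odd  : ∀ v → parity (suc (v + v)) ≡ 1
parity-even zero    = refl
parity-even (suc v) = trans (cong (λ t → parity (suc t)) (+-suc v v)) (cong (1 ∸_) (parity-odd v))
parity-odd v = cong (1 ∸_) (parity-even v)

half-even : ∀ v → half (v + v) ≡ v
half-odd  : ∀ v → half (suc (v + v)) ≡ v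
half-even zero    = refl
half-even (suc v) = begin
  half (suc (v + suc v))                         ≡⟨ cong (λ t → half (suc t)) (+-suc v v) ⟩
  half (suc (v + v)) + parity (suc (v + v))      ≡⟨ cong₂ _+_ (half-odd v) (parity-odd v) ⟩
  v + 1                                          ≡⟨ +-comm v 1 ⟩
  suc v                                          ∎
  where open ≡-Reasoning
half-odd v = trans (cong₂ _+_ (half-even v) (parity-even v)) (+-identityʳ v)

toBool : ℕ → Bool
toBool zero    = false
toBool (suc _) = true

toBool-bit : ∀ b → toBool (bit b) ≡ b
toBool-bit true  = refl
toBool-bit false = refl

toBool-reflects : ∀ {P n} → Reflectsᴺ P n → toBool n ≡ true ⇔ P
toBool-reflects (ofʸ p)  = mk⇔ (λ _ → p) (λ _ → refl)
toBool-reflects (ofⁿ ¬p) = mk⇔ (λ ()) (λ p → ⊥-elim (¬p p))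

`bool : ∀ {k} → Exp k → Exp k
`bool e = `ifz e (`n 0) (`n 1)

bit-toBool : ∀ n → ifz n 0 1 ≡ bit (toBool n)
bit-toBool zero    = refl
bit-toBool (suc n) = refl

eval-bool : ∀ A {k} (e : Exp k) xs → Eval A (compile (`bool e)) xs (bit (toBool (⟦ e ⟧ A xs)))
eval-bool A e xs = subst (Eval A _ xs) (bit-toBool (⟦ e ⟧ A xs)) (eval-compile A (`bool e) xs)

boolCode : Exp 1 → Code 1
boolCode e = compile (`bool e)

boolCode-computes : ∀ A e → Computes (boolCode e) A (λ n → toBool (⟦ e ⟧ A (n ∷ [])))
boolCode-computes A e n = eval-bool A e (n ∷ [])

searchCode : Exp 2 → Exp 2 → Code 1
searchCode test body = ccmp (compile (`bool body)) (cmin (compile test) ∷ cp zero ∷ [])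

searchCode-computes : ∀ A (test body : Exp 2) → (∀ z → ∃ λ j → ⟦ test ⟧ A (j ∷ z ∷ []) ≡ 0) →
  Σ (ℕ → ℕ) λ m → (∀ z → Least (λ j → ⟦ test ⟧ A (j ∷ z ∷ []) ≡ 0) (m z)) ×
                  Computes (searchCode test body) A (λ z → toBool (⟦ body ⟧ A (m z ∷ z ∷ [])))
searchCode-computes A test body found =
  (λ z → proj₁ (μ z)) , (λ z → proj₂ (proj₂ (μ z))) ,
  λ z → ev-cmp (evv-∷ (proj₁ (proj₂ (μ z))) (evv-∷ ev-p evv-[])) (eval-bool A body _)
  where
  μ : ∀ z → ∃ λ n → Eval A (cmin (compile test)) (z ∷ []) n × Least (λ j → ⟦ test ⟧ A (j ∷ z ∷ []) ≡ 0) n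
  μ z = eval-cmin A (compile test) (z ∷ []) (λ j → ⟦ test ⟧ A (j ∷ z ∷ []))
                  (λ j → eval-compile A test (j ∷ z ∷ [])) (found z)

-- The columns of the parallel instance built from X agree with X only pointwise.
Extensional : Problem → Set
Extensional Q = (∀ {X X′} → X ≗ X′ → Inst Q X → Inst Q X′) ×
                (∀ {X X′ T T′} → X ≗ X′ → T ≗ T′ → Sol Q X T → Sol Q X′ T′)

≤sW-parallel : ∀ Q → Extensional Q → Q ≤sW parallel Q
≤sW-parallel Q (inst-resp , sol-resp) =
  boolCode (`orc (`unpair₂ (`v (# 0)))) , boolCode (`orc (`pair (`n 0) (`v (# 0)))) , λ X iX →
  (λ z → toBool (bit (X (unpair₂ z)))) , boolCode-computes X (`orc (`unpair₂ (`v (# 0)))) ,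
  (λ i → inst-resp (λ n → sym (column-X {X} i n)) iX) ,
  λ T sT → (λ n → toBool (bit (T (pair′ 0 n)))) , boolCode-computes T (`orc (`pair (`n 0) (`v (# 0)))) ,
    sol-resp (column-X {X} 0) (λ n → sym (trans (toBool-bit _) (cong T (pair′≡pair 0 n)))) (sT 0)
  where
  column-X : ∀ {X} i n → toBool (bit (X (unpair₂ ⟪ i , n ⟫))) ≡ X n
  column-X {X} i n = trans (toBool-bit _) (cong X (unpair₂-pair i n))

Path-trans : ∀ {X a b c} → Path X a b → Path X b c → Path X a c
Path-trans (p-nil _)    q = q
Path-trans (p-cons e p) q = p-cons e (Path-trans p q)

true-resp-≗ : ∀ {X X′ : Cantor} → X ≗ X′ → ∀ {n} → X n ≡ true → X′ n ≡ true
true-resp-≗ X≗X′ {n} = trans (sym (X≗X′ n))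

Path-resp-≗ : ∀ {X X′} → X ≗ X′ → ∀ {a b} → Path X a b → Path X′ a b
Path-resp-≗ X≗X′ (p-nil v)    = p-nil (true-resp-≗ X≗X′ v)
Path-resp-≗ X≗X′ (p-cons e p) = p-cons (true-resp-≗ X≗X′ e) (Path-resp-≗ X≗X′ p)

module _ {X : Cantor} (G : IsGraph X) where
  private
    edge-vertices = proj₁ (proj₂ G)
    edge-sym      = proj₁ (proj₂ (proj₂ G))

  Path-vertexˡ : ∀ {a b} → Path X a b → Vert X a
  Path-vertexˡ (p-nil v)            = v
  Path-vertexˡ (p-cons {a} {b} e _) = proj₁ (edge-vertices a b e)

  Path-vertexʳ : ∀ {a b} → Path X a b → Vert X b
  Path-vertexʳ (p-nil v)    = v
  Path-vertexʳ (p-cons e p) = Path-vertexʳ p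

  Path-sym : ∀ {a b} → Path X a b → Path X b a
  Path-sym (p-nil v)            = p-nil v
  Path-sym (p-cons {a} {b} e p) =
    Path-trans (Path-sym p) (p-cons (edge-sym a b e) (p-nil (proj₁ (edge-vertices a b e))))

IsGraph-resp-≗ : ∀ {X X′} → X ≗ X′ → IsGraph X → IsGraph X′
IsGraph-resp-≗ X≗X′ (infinite , edge-vertices , edge-sym , loopless) =
  (λ n → let (v , n≤v , vert) = infinite n in v , n≤v , to vert) ,
  (λ a b e → let (va , vb) = edge-vertices a b (from e) in to va , to vb) ,
  (λ a b e → to (edge-sym a b (from e))) ,
  (λ a e → loopless a (from e))
  where
  to   = true-resp-≗ X≗X′
  from = true-resp-≗ (sym ∘ X≗X′)

IsComponent-resp-≗ : ∀ {X X′ C C′} → X ≗ X′ → C ≗ C′ → IsComponent X C → IsComponent X′ C′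
IsComponent-resp-≗ X≗X′ C≗C′ ((v , v∈C) , vertices , connected , closed) =
  (v , true-resp-≗ C≗C′ v∈C) ,
  (λ v h → true-resp-≗ X≗X′ (vertices v (C′⇒C h))) ,
  (λ a b ha hb → Path-resp-≗ X≗X′ (connected a b (C′⇒C ha) (C′⇒C hb))) ,
  (λ a b ha p → true-resp-≗ C≗C′ (closed a b (C′⇒C ha) (Path-resp-≗ (sym ∘ X≗X′) p)))
  where
  C′⇒C = true-resp-≗ (sym ∘ C≗C′)

IsDecomposition-resp-≗ : ∀ {X X′ T T′} → X ≗ X′ → T ≗ T′ → IsDecomposition X T → IsDecomposition X′ T′
IsDecomposition-resp-≗ X≗X′ T≗T′ (vertices , total , functional , separates) =
  (λ v n h → true-resp-≗ X≗X′ (vertices v n (T′⇒T h))) ,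
  (λ v h → let (n , h′) = total v (true-resp-≗ (sym ∘ X≗X′) h) in n , true-resp-≗ T≗T′ h′) ,
  (λ v n m h h′ → functional v n m (T′⇒T h) (T′⇒T h′)) ,
  (λ v₀ v₁ n₀ n₁ h h′ →
    let iff = separates v₀ v₁ n₀ n₁ (T′⇒T h) (T′⇒T h′)
    in mk⇔ (Path-resp-≗ X≗X′ ∘ Equivalence.to iff) (Equivalence.from iff ∘ Path-resp-≗ (sym ∘ X≗X′)))
  where
  T′⇒T = true-resp-≗ (sym ∘ T≗T′)

P-extensional : Extensional P
P-extensional = IsGraph-resp-≗ , IsComponent-resp-≗

D-extensional : Extensional D
D-extensional = IsGraph-resp-≗ , IsDecomposition-resp-≗

-- Parallel LPO reduces to P and to D

Zero : Cantor → ℕ → ℕ → Set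
Zero X j l = column X j ⟪ l , 0 ⟫ ≡ true

node : ℕ → ℕ → ℕ → ℕ
node v j k = suc ⟪ v , ⟪ j , k ⟫ ⟫

data Link (X : Cantor) : ℕ → ℕ → Set where
  link-root  : ∀ v j → Link X v (node v j 1)
  link-step  : ∀ v j k → Link X (node v j (suc k)) (node v j (suc (suc k)))
  link-close : ∀ v j k → Least (Zero X j) k → Link X (node v j 0) (node v j (suc k))

node-injective : ∀ {v j k v′ j′ k′} → node v j k ≡ node v′ j′ k′ → v ≡ v′ × j ≡ j′ × k ≡ k′
node-injective e with pair-injective (suc-injective e)
... | v≡v′ , jk≡j′k′ = v≡v′ , pair-injective jk≡j′k′

node-monoʳ-< : ∀ v j {k k′} → k < k′ → node v j k < node v j k′
node-monoʳ-< v j k<k′ = s≤s (pair-monoʳ-< v (pair-monoʳ-< j k<k′))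

Link-< : ∀ {X a b} → Link X a b → a < b
Link-< (link-root v j)        = s≤s (m≤pair v _)
Link-< (link-step v j k)      = node-monoʳ-< v j ≤-refl
Link-< (link-close v j k _)   = node-monoʳ-< v j z<s

nodeV nodeJ nodeK : ℕ → ℕ
nodeV b = unpair₁ (b ∸ 1)
nodeJ b = unpair₁ (unpair₂ (b ∸ 1))
nodeK b = unpair₂ (unpair₂ (b ∸ 1))

node-nodeV-nodeJ-nodeK : ∀ w → node (nodeV (suc w)) (nodeJ (suc w)) (nodeK (suc w)) ≡ suc w
node-nodeV-nodeJ-nodeK w =
  cong suc (trans (cong (λ u → ⟪ unpair₁ w , u ⟫) (pair-unpair (unpair₂ w))) (pair-unpair w))

nodeV-node : ∀ v j k → nodeV (node v j k) ≡ v
nodeV-node v j k = unpair₁-pair v _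

nodeJ-node : ∀ v j k → nodeJ (node v j k) ≡ j
nodeJ-node v j k = trans (cong unpair₁ (unpair₂-pair v _)) (unpair₁-pair j k)

nodeK-node : ∀ v j k → nodeK (node v j k) ≡ k
nodeK-node v j k = trans (cong unpair₂ (unpair₂-pair v _)) (unpair₂-pair j k)

LinkCase : Cantor → ℕ → ℕ → ℕ → ℕ → Set
LinkCase X a v j k =
  (k ≡ 1 × a ≡ v) ⊎ (2 ≤ k × a ≡ node v j (k ∸ 1)) ⊎ (1 ≤ k × a ≡ node v j 0 × Least (Zero X j) (k ∸ 1))

LinkCase⇒Link : ∀ {X a} v j k → LinkCase X a v j k → Link X a (node v j k)
LinkCase⇒Link v j _             (inj₁ (refl , refl))               = link-root v j
LinkCase⇒Link v j (suc (suc k)) (inj₂ (inj₁ (_ , refl)))           = link-step v j k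
LinkCase⇒Link v j (suc zero)    (inj₂ (inj₁ (s≤s () , _)))
LinkCase⇒Link v j (suc k)       (inj₂ (inj₂ (_ , refl , least)))   = link-close v j k least

Link⇒LinkCase : ∀ {X a b} → Link X a b → LinkCase X a (nodeV b) (nodeJ b) (nodeK b)
Link⇒LinkCase (link-root v j)
  rewrite nodeV-node v j 1 | nodeJ-node v j 1 | nodeK-node v j 1 = inj₁ (refl , refl)
Link⇒LinkCase (link-step v j k)
  rewrite nodeV-node v j (2 + k) | nodeJ-node v j (2 + k) | nodeK-node v j (2 + k) =
  inj₂ (inj₁ (s≤s (s≤s z≤n) , refl))
Link⇒LinkCase (link-close v j k least)
  rewrite nodeV-node v j (suc k) | nodeJ-node v j (suc k) | nodeK-node v j (suc k) =
  inj₂ (inj₂ (s≤s z≤n , refl , least))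

`node : ∀ {k} → Exp k → Exp k → Exp k → Exp k
`node v j k = `n 1 `+ `pair v (`pair j k)

-- b↑ is b again, in the scope of the two variables bound by `∀<
`link : ∀ {k} → Exp k → Exp k → Exp (suc (suc k)) → Exp k
`link a b b↑ = `n 1 `≤ b `∧ ((k `≡ `n 1 `∧ a `≡ v)
                            `∨ (`n 2 `≤ k `∧ a `≡ `node v j (k `∸ `n 1))
                            `∨ (`n 1 `≤ k `∧ a `≡ `node v j (`n 0) `∧
                                `orc (`pair j (`pair (k `∸ `n 1) (`n 0))) `∧
                                `∀< (k `∸ `n 1) (`¬ `orc (`pair j↑ (`pair (`v (# 0)) (`n 0))))))
  where
  v = `unpair₁ (b `∸ `n 1)
  j = `unpair₁ (`unpair₂ (b `∸ `n 1))
  k = `unpair₂ (`unpair₂ (b `∸ `n 1))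
  j↑ = `unpair₁ (`unpair₂ (b↑ `∸ `n 1))

linkᴺ : Cantor → ℕ → ℕ → ℕ
linkᴺ X a b = ⟦ `link (`v (# 0)) (`v (# 1)) (`v (# 3)) ⟧ X (a ∷ b ∷ [])

pair′-pair′≡ : ∀ a b c → pair′ a (pair′ b c) ≡ ⟪ a , ⟪ b , c ⟫ ⟫
pair′-pair′≡ a b c = trans (cong (pair′ a) (pair′≡pair b c)) (pair′≡pair a _)

node′ : ℕ → ℕ → ℕ → ℕ
node′ v j k = suc (pair′ v (pair′ j k))

node′≡node : ∀ v j k → node′ v j k ≡ node v j k
node′≡node v j k = cong suc (pair′-pair′≡ v j k)

≡node-reflects : ∀ a v j k → Reflectsᴺ (a ≡ node v j k) (a ≡ᴺ node′ v j k)
≡node-reflects a v j k = Reflectsᴺ-map (λ e → trans e (node′≡node v j k))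
                                       (λ e → trans e (sym (node′≡node v j k)))
                                       (≡ᴺ-reflects a _)

Zero-reflects : ∀ X j l → Reflectsᴺ (Zero X j l) (bit (X (pair′ j (pair′ l 0))))
Zero-reflects X j l = bit-reflects X (pair′-pair′≡ j l 0)

linkᴺ-reflects′ : ∀ X a b → Reflectsᴺ (1 ≤ b × LinkCase X a (nodeV b) (nodeJ b) (nodeK b)) (linkᴺ X a b)
linkᴺ-reflects′ X a b =
  ∧ᴺ-reflects (≤ᴺ-reflects 1 b)
  (∨ᴺ-reflects (∧ᴺ-reflects (≡ᴺ-reflects k 1) (≡ᴺ-reflects a v))
  (∨ᴺ-reflects (∧ᴺ-reflects (≤ᴺ-reflects 2 k) (≡node-reflects a v j (k ∸ 1)))
               (∧ᴺ-reflects (≤ᴺ-reflects 1 k) (∧ᴺ-reflects (≡node-reflects a v j 0)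
                 (∧ᴺ-reflects (Zero-reflects X j (k ∸ 1))
                              (∀<ᴺ-reflects (λ l → ¬ᴺ bit (X (pair′ j (pair′ l 0))))
                                            (λ l → ¬ᴺ-reflects (Zero-reflects X j l)) (k ∸ 1)))))))
  where
  v = nodeV b
  j = nodeJ b
  k = nodeK b

linkᴺ-reflects : ∀ X a b → Reflectsᴺ (Link X a b) (linkᴺ X a b)
linkᴺ-reflects X a b = Reflectsᴺ-map (to b) from (linkᴺ-reflects′ X a b)
  where
  to : ∀ b → 1 ≤ b × LinkCase X a (nodeV b) (nodeJ b) (nodeK b) → Link X a b
  to (suc w) (_ , c) =
    subst (Link X a) (node-nodeV-nodeJ-nodeK w) (LinkCase⇒Link (nodeV (suc w)) (nodeJ (suc w)) (nodeK (suc w)) c)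
  from : Link X a b → 1 ≤ b × LinkCase X a (nodeV b) (nodeJ b) (nodeK b)
  from link = ≤-trans (s≤s z≤n) (Link-< link) , Link⇒LinkCase link

`gadget : Exp 1
`gadget = `ifz (`parity z) (`n 1) (`link h₁ h₂ h₂↑ `∨ `link h₂ h₁ h₁↑)
  where
  z   = `v (# 0)
  h₁  = `unpair₁ (`half z)
  h₂  = `unpair₂ (`half z)
  h₁↑ = `unpair₁ (`half (`v (# 2)))
  h₂↑ = `unpair₂ (`half (`v (# 2)))

gadgetᴺ : Cantor → ℕ → ℕ
gadgetᴺ X z = ifz (parity z) 1 (linkᴺ X (unpair₁ (half z)) (unpair₂ (half z)) ∨ᴺ
                                 linkᴺ X (unpair₂ (half z)) (unpair₁ (half z)))

gadget : Cantor → Cantor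
gadget X z = toBool (gadgetᴺ X z)

gadgetᴺ-even : ∀ X v → gadgetᴺ X (2 * v) ≡ 1
gadgetᴺ-even X v rewrite 2*n≡n+n v | parity-even v = refl

gadgetᴺ-odd : ∀ X a b → gadgetᴺ X (suc (2 * ⟪ a , b ⟫)) ≡ (linkᴺ X a b ∨ᴺ linkᴺ X b a)
gadgetᴺ-odd X a b
  rewrite 2*n≡n+n ⟪ a , b ⟫ | parity-odd ⟪ a , b ⟫ | half-odd ⟪ a , b ⟫ | unpair₁-pair a b | unpair₂-pair a b = refl

gadget-vertex : ∀ X v → Vert (gadget X) v
gadget-vertex X v = cong toBool (gadgetᴺ-even X v)

gadget-edge : ∀ X a b → Edge (gadget X) a b ⇔ (Link X a b ⊎ Link X b a)
gadget-edge X a b = subst (λ n → toBool n ≡ true ⇔ (Link X a b ⊎ Link X b a)) (sym (gadgetᴺ-odd X a b))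
                          (toBool-reflects (∨ᴺ-reflects (linkᴺ-reflects X a b) (linkᴺ-reflects X b a)))

Link⇒edge : ∀ X {a b} → Link X a b → Edge (gadget X) a b
Link⇒edge X {a} {b} link = Equivalence.from (gadget-edge X a b) (inj₁ link)

Link⇒edge⁻¹ : ∀ X {a b} → Link X a b → Edge (gadget X) b a
Link⇒edge⁻¹ X {a} {b} link = Equivalence.from (gadget-edge X b a) (inj₂ link)

gadget-isGraph : ∀ X → IsGraph (gadget X)
gadget-isGraph X =
  (λ n → n , ≤-refl , gadget-vertex X n) ,
  (λ a b _ → gadget-vertex X a , gadget-vertex X b) ,
  (λ a b e → Equivalence.from (gadget-edge X b a) (swap (Equivalence.to (gadget-edge X a b) e))) ,
  (λ a e → [ irrefl , irrefl ]′ (Equivalence.to (gadget-edge X a a) e))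
  where
  irrefl : ∀ {a} → Link X a a → ⊥
  irrefl link = <-irrefl refl (Link-< link)

data Descendant (y₀ : ℕ) : ℕ → Set where
  self  : Descendant y₀ y₀
  child : ∀ {v} j k → Descendant y₀ v → Descendant y₀ (node v j k)

Descendant-≤ : ∀ {y₀ z} → Descendant y₀ z → y₀ ≤ z
Descendant-≤ self               = ≤-refl
Descendant-≤ (child {v} j k d)  = ≤-trans (Descendant-≤ d) (m≤n⇒m≤1+n (m≤pair v ⟪ j , k ⟫))

Descendant-node⁻ : ∀ {y₀} v j k → Descendant y₀ (node v j k) → node v j k ≡ y₀ ⊎ Descendant y₀ v
Descendant-node⁻ v j k d = parent d refl
  where
  parent : ∀ {y₀ z} → Descendant y₀ z → z ≡ node v j k → node v j k ≡ y₀ ⊎ Descendant y₀ v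
  parent self                 e = inj₁ (sym e)
  parent (child {v′} j′ k′ d) e with node-injective {v′} {j′} {k′} {v} {j} {k} e
  ... | refl , _ , _ = inj₂ d

-- Only the closing edge at node x j 0 can leave the descendants of node x j 0, and it exists only if p_j has a zero.
module Separation (X : Cantor) (x j : ℕ) where

  y₀ : ℕ
  y₀ = node x j 0

  node≢y₀ : ∀ v j′ k → node v j′ (suc k) ≢ y₀
  node≢y₀ v j′ k e with node-injective {v} {j′} {suc k} {x} {j} {0} e
  ... | _ , _ , ()

  Link-down : ∀ {a b} → Link X a b → Descendant y₀ b → Descendant y₀ a ⊎ ∃ (Zero X j)
  Link-down (link-root v j′) d with Descendant-node⁻ v j′ 1 d
  ... | inj₁ e  = ⊥-elim (node≢y₀ v j′ 0 e)
  ... | inj₂ dv = inj₁ dv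
  Link-down (link-step v j′ k) d with Descendant-node⁻ v j′ (suc (suc k)) d
  ... | inj₁ e  = ⊥-elim (node≢y₀ v j′ (suc k) e)
  ... | inj₂ dv = inj₁ (child j′ (suc k) dv)
  Link-down (link-close v j′ k _) d with Descendant-node⁻ v j′ (suc k) d
  ... | inj₁ e  = ⊥-elim (node≢y₀ v j′ k e)
  ... | inj₂ dv = inj₁ (child j′ 0 dv)

  Link-up : ∀ {a b} → Link X a b → Descendant y₀ a → Descendant y₀ b ⊎ ∃ (Zero X j)
  Link-up (link-root v j′) d = inj₁ (child j′ 1 d)
  Link-up (link-step v j′ k) d with Descendant-node⁻ v j′ (suc k) d
  ... | inj₁ e  = ⊥-elim (node≢y₀ v j′ k e)
  ... | inj₂ dv = inj₁ (child j′ (suc (suc k)) dv)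
  Link-up (link-close v j′ k (zero-k , _)) d with Descendant-node⁻ v j′ 0 d
  ... | inj₂ dv = inj₁ (child j′ (suc k) dv)
  ... | inj₁ e  with node-injective {v} {j′} {0} {x} {j} {0} e
  ...   | _ , refl , _ = inj₂ (k , zero-k)

  Path-Descendant : ∀ {a c} → Path (gadget X) a c → Descendant y₀ c → Descendant y₀ a ⊎ ∃ (Zero X j)
  Path-Descendant (p-nil _) d = inj₁ d
  Path-Descendant (p-cons {a} {b} e p) d with Path-Descendant p d
  ... | inj₂ zero-j = inj₂ zero-j
  ... | inj₁ db with Equivalence.to (gadget-edge X a b) e
  ...   | inj₁ link = Link-down link db
  ...   | inj₂ link = Link-up link db

  Path⇒Zero : Path (gadget X) x y₀ → ∃ (Zero X j)
  Path⇒Zero p with Path-Descendant p self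
  ... | inj₂ zero-j = zero-j
  ... | inj₁ dx     = ⊥-elim (<⇒≱ (s≤s (m≤pair x ⟪ j , 0 ⟫)) (Descendant-≤ dx))

  climb : ∀ k → Path (gadget X) (node x j 1) (node x j (suc k))
  climb zero    = p-nil (gadget-vertex X (node x j 1))
  climb (suc k) = Path-trans (climb k) (p-cons (Link⇒edge X (link-step x j k))
                                               (p-nil (gadget-vertex X (node x j (suc (suc k))))))

  Zero⇒Path : ∃ (Zero X j) → Path (gadget X) x y₀
  Zero⇒Path (l , zero-l) with Least-exists {Zero X j} (λ l → column X j ⟪ l , 0 ⟫ Bool.≟ true) {l} zero-l
  ... | k , least =
    p-cons (Link⇒edge X (link-root x j))
           (Path-trans (climb k) (p-cons (Link⇒edge⁻¹ X (link-close x j k least)) (p-nil (gadget-vertex X y₀))))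

  Path⇔Zero : Path (gadget X) x y₀ ⇔ ∃ (Zero X j)
  Path⇔Zero = mk⇔ Path⇒Zero Zero⇒Path

IsComponent-member⇔Path : ∀ {X C a b} → IsComponent X C → C a ≡ true → C b ≡ true ⇔ Path X a b
IsComponent-member⇔Path (_ , _ , connected , closed) a∈C =
  mk⇔ (connected _ _ a∈C) (closed _ _ a∈C)

IsDecomposition-label⇔Path : ∀ {X T a b n} → IsDecomposition X T → T ⟪ a , n ⟫ ≡ true → Vert X b →
                             T ⟪ b , n ⟫ ≡ true ⇔ Path X a b
IsDecomposition-label⇔Path {T = T} {b = b} {n} (_ , total , _ , separates) a↦n vert-b =
  mk⇔ (λ b↦n → Equivalence.to (separates _ _ _ _ a↦n b↦n) refl)
      (λ path → let (n′ , b↦n′) = total b vert-b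
                in subst (λ l → T ⟪ b , l ⟫ ≡ true) (sym (Equivalence.from (separates _ _ _ _ a↦n b↦n′) path)) b↦n′)

Sol-from-gadget : ∀ X Y (r : ℕ → ℕ) →
  (∀ i k → Y ⟪ i , k ⟫ ≡ true ⇔ Path (gadget X) (r ⟪ i , k ⟫) (node (r ⟪ i , k ⟫) i 0)) →
  Sol (parallel LPO) X Y
Sol-from-gadget X Y r answers i k = ⇔-trans (answers i k) (Separation.Path⇔Zero X (r ⟪ i , k ⟫) i)

-- a component C is queried at its least member r
parallelLPO≤sWP : parallel LPO ≤sW P
parallelLPO≤sWP = boolCode `gadget , searchCode test answer , λ X _ →
  gadget X , boolCode-computes X `gadget , gadget-isGraph X ,
  λ C component →
    let (v₀ , v₀∈C) = proj₁ component
        (root , root-least , computes) = searchCode-computes C test answer (λ _ → v₀ , from (member C v₀) v₀∈C)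
        Y = λ z → toBool (⟦ answer ⟧ C (root z ∷ z ∷ []))
    in Y , computes , Sol-from-gadget X Y root λ i k →
         let r = root ⟪ i , k ⟫
         in subst (λ b → b ≡ true ⇔ Path (gadget X) r (node r i 0)) (sym (answer≡ C r i k))
                  (IsComponent-member⇔Path component (to (member C r) (proj₁ (root-least ⟪ i , k ⟫))))
  where
  open Equivalence
  test answer : Exp 2
  test   = `¬ `orc (`v (# 0))
  answer = `orc (`node (`v (# 0)) (`unpair₁ (`v (# 1))) (`n 0))
  member : ∀ C j → ¬ᴺ bit (C j) ≡ 0 ⇔ C j ≡ true
  member C j = ¬ᴺ≡0⇔ (bit-reflects C refl)
  answer≡ : ∀ C r i k → toBool (bit (C (node′ r (unpair₁ ⟪ i , k ⟫) 0))) ≡ C (node r i 0)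
  answer≡ C r i k = trans (toBool-bit _) (cong C (trans (cong (λ u → node′ r u 0) (unpair₁-pair i k)) (node′≡node r i 0)))

-- a decomposition T is queried for the label n of vertex 0
parallelLPO≤sWD : parallel LPO ≤sW D
parallelLPO≤sWD = boolCode `gadget , searchCode test answer , λ X _ →
  gadget X , boolCode-computes X `gadget , gadget-isGraph X ,
  λ T decomposition →
    let (n₀ , 0↦n₀) = proj₁ (proj₂ decomposition) 0 (gadget-vertex X 0)
        (label , label-least , computes) = searchCode-computes T test answer (λ _ → n₀ , from (labels T n₀) 0↦n₀)
        Y = λ z → toBool (⟦ answer ⟧ T (label z ∷ z ∷ []))
    in Y , computes , Sol-from-gadget X Y (λ _ → 0) λ i k →
         let n = label ⟪ i , k ⟫
         in subst (λ b → b ≡ true ⇔ Path (gadget X) 0 (node 0 i 0)) (sym (answer≡ T n i k))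
                  (IsDecomposition-label⇔Path {T = T} {n = n} decomposition (to (labels T n) (proj₁ (label-least ⟪ i , k ⟫)))
                                              (gadget-vertex X (node 0 i 0)))
  where
  open Equivalence
  test answer : Exp 2
  test   = `¬ `orc (`pair (`n 0) (`v (# 0)))
  answer = `orc (`pair (`node (`n 0) (`unpair₁ (`v (# 1))) (`n 0)) (`v (# 0)))
  labels : ∀ T n → ¬ᴺ bit (T (pair′ 0 n)) ≡ 0 ⇔ T ⟪ 0 , n ⟫ ≡ true
  labels T n = ¬ᴺ≡0⇔ (bit-reflects T (pair′≡pair 0 n))
  answer≡ : ∀ T n i k → toBool (bit (T (pair′ (node′ 0 (unpair₁ ⟪ i , k ⟫) 0) n))) ≡ T ⟪ node 0 i 0 , n ⟫
  answer≡ T n i k = trans (toBool-bit _)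
    (cong T (trans (cong (λ u → pair′ (node′ 0 u 0) n) (unpair₁-pair i k))
                   (trans (cong (λ u → pair′ u n) (node′≡node 0 i 0)) (pair′≡pair (node 0 i 0) n))))

-- Parallel P and parallel D reduce to parallel LPO

-- s codes the vertex sequence unpair₁ s , unpair₁ (unpair₂ s) , unpair₁ (unpair₂ (unpair₂ s)) , …
`vertexAt : ∀ {k} → Exp k → Exp k → Exp k
`vertexAt l s = `unpair₁ (`rec l s (`unpair₂ (`v (# 1))))

vertexAt : ℕ → ℕ → ℕ
vertexAt l s = unpair₁ (primRec s (λ _ → unpair₂) l)

vertexAt-suc : ∀ l s → vertexAt (suc l) s ≡ vertexAt l (unpair₂ s)
vertexAt-suc l s = cong unpair₁ (iterate-suc l s)
  where
  iterate-suc : ∀ l s → primRec s (λ _ → unpair₂) (suc l) ≡ primRec (unpair₂ s) (λ _ → unpair₂) l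
  iterate-suc zero    s = refl
  iterate-suc (suc l) s = cong unpair₂ (iterate-suc l s)

vertexAt-cons : ∀ l a s → vertexAt (suc l) ⟪ a , s ⟫ ≡ vertexAt l s
vertexAt-cons l a s = trans (vertexAt-suc l ⟪ a , s ⟫) (cong (vertexAt l) (unpair₂-pair a s))

IsWalk : Cantor → (i len s : ℕ) → Set
IsWalk X i len s = Vert (column X i) (vertexAt len s) ×
                   (∀ l → l < len → Edge (column X i) (vertexAt l s) (vertexAt (suc l) s))

Walk : Cantor → (i a b len s : ℕ) → Set
Walk X i a b len s = vertexAt 0 s ≡ a × vertexAt len s ≡ b × IsWalk X i len s

module _ (X : Cantor) (i : ℕ) where

  IsWalk⇒Path : ∀ len s → IsWalk X i len s → Path (column X i) (vertexAt 0 s) (vertexAt len s)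
  IsWalk⇒Path zero    s (vert , _)     = p-nil vert
  IsWalk⇒Path (suc len) s (vert , edges) =
    p-cons (edges 0 z<s) (subst (Path (column X i) _) (sym (vertexAt-suc len s)) (IsWalk⇒Path len (unpair₂ s) tail))
    where
    tail : IsWalk X i len (unpair₂ s)
    tail = subst (Vert (column X i)) (vertexAt-suc len s) vert ,
           λ l l<len → subst₂ (Edge (column X i)) (vertexAt-suc l s) (vertexAt-suc (suc l) s) (edges (suc l) (s≤s l<len))

  Walk⇒Path : ∀ {a b len s} → Walk X i a b len s → Path (column X i) a b
  Walk⇒Path {len = len} {s} (refl , refl , walk) = IsWalk⇒Path len s walk

  Path⇒Walk : ∀ {a b} → Path (column X i) a b → ∃ λ len → ∃ λ s → Walk X i a b len s
  Path⇒Walk (p-nil {a} vert) =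
    0 , ⟪ a , 0 ⟫ , unpair₁-pair a 0 , unpair₁-pair a 0 ,
    subst (Vert (column X i)) (sym (unpair₁-pair a 0)) vert , λ l ()
  Path⇒Walk (p-cons {a} e p) with Path⇒Walk p
  ... | len , s , start , end , vert , edges =
    suc len , ⟪ a , s ⟫ , unpair₁-pair a s , trans (vertexAt-cons len a s) end ,
    subst (Vert (column X i)) (sym (vertexAt-cons len a s)) vert , edges′
    where
    edges′ : ∀ l → l < suc len → Edge (column X i) (vertexAt l ⟪ a , s ⟫) (vertexAt (suc l) ⟪ a , s ⟫)
    edges′ zero    _       = subst₂ (Edge (column X i)) (sym (unpair₁-pair a s))
                                    (sym (trans (vertexAt-cons 0 a s) start)) e
    edges′ (suc l) l<1+len = subst₂ (Edge (column X i)) (sym (vertexAt-cons l a s)) (sym (vertexAt-cons (suc l) a s))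
                                    (edges l (m<1+n⇒m≤n l<1+len))

-- i↑ and s↑ are i and s again, in the scope of the two variables bound by `∀<
`walk : ∀ {k} → (i a b len s : Exp k) → (i↑ s↑ : Exp (suc (suc k))) → Exp k
`walk i a b len s i↑ s↑ =
  `vertexAt (`n 0) s `≡ a `∧ `vertexAt len s `≡ b `∧ `orc (`pair i (end `+ end)) `∧
  `∀< len (`orc (`pair i↑ (`n 1 `+ (step `+ step))))
  where
  end  = `vertexAt len s
  step = `pair (`vertexAt (`v (# 0)) s↑) (`vertexAt (`n 1 `+ `v (# 0)) s↑)

walkᴺ : Cantor → (i a b len s : ℕ) → ℕ
walkᴺ X i a b len s =
  ⟦ `walk (`v (# 0)) (`v (# 1)) (`v (# 2)) (`v (# 3)) (`v (# 4)) (`v (# 2)) (`v (# 6)) ⟧ X (i ∷ a ∷ b ∷ len ∷ s ∷ [])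

walkᴺ-reflects : ∀ X i a b len s → Reflectsᴺ (Walk X i a b len s) (walkᴺ X i a b len s)
walkᴺ-reflects X i a b len s =
  ∧ᴺ-reflects (≡ᴺ-reflects _ a) (∧ᴺ-reflects (≡ᴺ-reflects _ b) (∧ᴺ-reflects (bit-reflects X (vertex-index (vertexAt len s)))
    (∀<ᴺ-reflects (λ l → bit (X (pair′ i (suc (edge l + edge l)))))
                  (λ l → bit-reflects X (edge-index (vertexAt l s) (vertexAt (suc l) s))) len)))
  where
  edge : ℕ → ℕ
  edge l = pair′ (vertexAt l s) (vertexAt (suc l) s)
  vertex-index : ∀ u → pair′ i (u + u) ≡ ⟪ i , 2 * u ⟫
  vertex-index u = trans (pair′≡pair i _) (cong ⟪ i ,_⟫ (sym (2*n≡n+n u)))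
  edge-index : ∀ u w → pair′ i (suc (pair′ u w + pair′ u w)) ≡ ⟪ i , suc (2 * ⟪ u , w ⟫) ⟫
  edge-index u w = trans (pair′≡pair i _)
    (cong (λ t → ⟪ i , suc t ⟫) (trans (cong (λ q → q + q) (pair′≡pair u w)) (sym (2*n≡n+n ⟪ u , w ⟫))))

-- Instance t = ⟪ i , ⟪ a , b ⟫ ⟫ of parallel LPO is the function n ↦ 0 if n = ⟪ len , s ⟫ codes a walk from a to b
-- in graph i, and n ↦ 1 otherwise.
pathQueryᴺ : Cantor → ℕ → ℕ → ℕ
pathQueryᴺ X t n = ¬ᴺ walkᴺ X (unpair₁ t) (unpair₁ (unpair₂ t)) (unpair₂ (unpair₂ t)) (unpair₁ n) (unpair₂ n)

`pathQueries : Exp 1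
`pathQueries = `¬ `walk i a b len s i↑ s↑ `≡ m
  where
  z   = `v (# 0)
  t   = `unpair₁ z
  n   = `unpair₁ (`unpair₂ z)
  m   = `unpair₂ (`unpair₂ z)
  i   = `unpair₁ t
  a   = `unpair₁ (`unpair₂ t)
  b   = `unpair₂ (`unpair₂ t)
  len = `unpair₁ n
  s   = `unpair₂ n
  i↑  = `unpair₁ (`unpair₁ (`v (# 2)))
  s↑  = `unpair₂ (`unpair₁ (`unpair₂ (`v (# 2))))

pathQueries : Cantor → Cantor
pathQueries X z = toBool (pathQueryᴺ X (unpair₁ z) (unpair₁ (unpair₂ z)) ≡ᴺ unpair₂ (unpair₂ z))

pathQueries-computes : ∀ X → Computes (boolCode `pathQueries) X (pathQueries X)
pathQueries-computes X = boolCode-computes X `pathQueries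

pathQueries-isInstance : ∀ X → Inst (parallel LPO) (pathQueries X)
pathQueries-isInstance X t = pathQueryᴺ X t , λ n m →
  subst (λ b → b ≡ true ⇔ pathQueryᴺ X t n ≡ m) (sym (pathQueries-pair n m)) (toBool-reflects (≡ᴺ-reflects _ m))
  where
  pathQueries-pair : ∀ n m → pathQueries X ⟪ t , ⟪ n , m ⟫ ⟫ ≡ toBool (pathQueryᴺ X t n ≡ᴺ m)
  pathQueries-pair n m rewrite unpair₁-pair t ⟪ n , m ⟫ | unpair₂-pair t ⟪ n , m ⟫ | unpair₁-pair n m | unpair₂-pair n m = refl

pathQueryᴺ≡0⇔Walk : ∀ X i a b n → pathQueryᴺ X ⟪ i , ⟪ a , b ⟫ ⟫ n ≡ 0 ⇔ Walk X i a b (unpair₁ n) (unpair₂ n)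
pathQueryᴺ≡0⇔Walk X i a b n
  rewrite unpair₁-pair i ⟪ a , b ⟫ | unpair₂-pair i ⟪ a , b ⟫ | unpair₁-pair a b | unpair₂-pair a b =
  ¬ᴺ≡0⇔ (walkᴺ-reflects X i a b (unpair₁ n) (unpair₂ n))

`query : ∀ {k} → Exp k → Exp k → Exp k → Exp k
`query i a b = `orc (`pair (`pair i (`pair a b)) (`n 0))

queryIndex : ℕ → ℕ → ℕ → ℕ
queryIndex i a b = pair′ (pair′ i (pair′ a b)) 0

queryIndex≡ : ∀ i a b → queryIndex i a b ≡ ⟪ ⟪ i , ⟪ a , b ⟫ ⟫ , 0 ⟫
queryIndex≡ i a b = trans (cong (λ q → pair′ q 0) (pair′-pair′≡ i a b)) (pair′≡pair ⟪ i , ⟪ a , b ⟫ ⟫ 0)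

module PathAnswers (X T : Cantor) (sT : Sol (parallel LPO) (pathQueries X) T) where

  answer⇔Path : ∀ i a b → T (queryIndex i a b) ≡ true ⇔ Path (column X i) a b
  answer⇔Path i a b = mk⇔ to from
    where
    t = ⟪ i , ⟪ a , b ⟫ ⟫
    LPO-answer = sT t 0
    query-answer : ∀ n → pathQueries X ⟪ t , ⟪ n , 0 ⟫ ⟫ ≡ true ⇔ Walk X i a b (unpair₁ n) (unpair₂ n)
    query-answer n = ⇔-trans (proj₂ (pathQueries-isInstance X t) n 0) (pathQueryᴺ≡0⇔Walk X i a b n)
    to : T (queryIndex i a b) ≡ true → Path (column X i) a b
    to h = let (n , hn) = Equivalence.to LPO-answer (trans (cong T (sym (queryIndex≡ i a b))) h)
           in Walk⇒Path X i (Equivalence.to (query-answer n) hn)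
    from : Path (column X i) a b → T (queryIndex i a b) ≡ true
    from p = let (len , s , walk) = Path⇒Walk X i p
                 walk′ = subst₂ (Walk X i a b) (sym (unpair₁-pair len s)) (sym (unpair₂-pair len s)) walk
             in trans (cong T (queryIndex≡ i a b))
                      (Equivalence.from LPO-answer (⟪ len , s ⟫ , Equivalence.from (query-answer ⟪ len , s ⟫) walk′))

  answer-reflects : ∀ i a b → Reflectsᴺ (Path (column X i) a b) (bit (T (queryIndex i a b)))
  answer-reflects i a b =
    Reflectsᴺ-map (Equivalence.to (answer⇔Path i a b)) (Equivalence.from (answer⇔Path i a b)) (bit-reflects T refl)

IsComponent-fromRoot : ∀ {X C r} → IsGraph X → Path X r r → (∀ u → C u ≡ true ⇔ Path X r u) → IsComponent X C
IsComponent-fromRoot {r = r} G r-r member =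
  (r , from r r-r) ,
  (λ v h → Path-vertexʳ G (to v h)) ,
  (λ a b ha hb → Path-trans (Path-sym G (to a ha)) (to b hb)) ,
  (λ a b ha p → from b (Path-trans (to a ha) p))
  where
  to   = λ u → Equivalence.to (member u)
  from = λ u → Equivalence.from (member u)

-- on input ⟪ i , u ⟫, find the least vertex r of graph i and answer whether r and u are connected
rootTest rootAnswer : Exp 2
rootTest   = `¬ `query (`unpair₁ (`v (# 1))) (`v (# 0)) (`v (# 0))
rootAnswer = `query (`unpair₁ (`v (# 1))) (`v (# 0)) (`unpair₂ (`v (# 1)))

module ComponentsFromAnswers (X : Cantor) (graphs : Inst (parallel P) X)
                             (T : Cantor) (sT : Sol (parallel LPO) (pathQueries X) T) where
  open PathAnswers X T sT

  rootTest≡0⇔ : ∀ z j → ⟦ rootTest ⟧ T (j ∷ z ∷ []) ≡ 0 ⇔ Path (column X (unpair₁ z)) j j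
  rootTest≡0⇔ z j = ¬ᴺ≡0⇔ (answer-reflects (unpair₁ z) j j)

  has-vertex : ∀ z → ∃ λ j → ⟦ rootTest ⟧ T (j ∷ z ∷ []) ≡ 0
  has-vertex z = let (v , _ , vert) = proj₁ (graphs (unpair₁ z)) 0
                 in v , Equivalence.from (rootTest≡0⇔ z v) (p-nil vert)

  search : Σ (ℕ → ℕ) λ m → (∀ z → Least (λ j → ⟦ rootTest ⟧ T (j ∷ z ∷ []) ≡ 0) (m z)) ×
                  Computes (searchCode rootTest rootAnswer) T (λ z → toBool (⟦ rootAnswer ⟧ T (m z ∷ z ∷ [])))
  search = searchCode-computes T rootTest rootAnswer has-vertex

  root : ℕ → ℕ
  root = proj₁ search

  root-least : ∀ i u → Least (λ j → Path (column X i) j j) (root ⟪ i , u ⟫)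
  root-least i u = subst (λ i′ → Least (λ j → Path (column X i′) j j) (root ⟪ i , u ⟫)) (unpair₁-pair i u)
                         (Least-map (rootTest≡0⇔ ⟪ i , u ⟫) (proj₁ (proj₂ search) ⟪ i , u ⟫))

  root-column : ∀ i u → root ⟪ i , u ⟫ ≡ root ⟪ i , 0 ⟫
  root-column i u = Least-unique {Q₀ = IsVertex} {Q₁ = IsVertex} (λ _ p → p) (λ _ p → p) (root-least i u) (root-least i 0)
    where
    IsVertex : ℕ → Set
    IsVertex j = Path (column X i) j j

  components : Cantor
  components z = toBool (⟦ rootAnswer ⟧ T (root z ∷ z ∷ []))

  components-member : ∀ i u → column components i u ≡ true ⇔ Path (column X i) (root ⟪ i , 0 ⟫) u
  components-member i u =
    subst (λ b → b ≡ true ⇔ Path (column X i) (root ⟪ i , 0 ⟫) u) (sym components≡) (answer⇔Path i (root ⟪ i , 0 ⟫) u)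
    where
    components≡ : components ⟪ i , u ⟫ ≡ T (queryIndex i (root ⟪ i , 0 ⟫) u)
    components≡ = begin
      toBool (bit (T (queryIndex (unpair₁ ⟪ i , u ⟫) (root ⟪ i , u ⟫) (unpair₂ ⟪ i , u ⟫))))
        ≡⟨ toBool-bit _ ⟩
      T (queryIndex (unpair₁ ⟪ i , u ⟫) (root ⟪ i , u ⟫) (unpair₂ ⟪ i , u ⟫))
        ≡⟨ cong₂ (λ i′ u′ → T (queryIndex i′ (root ⟪ i , u ⟫) u′)) (unpair₁-pair i u) (unpair₂-pair i u) ⟩
      T (queryIndex i (root ⟪ i , u ⟫) u)
        ≡⟨ cong (λ r → T (queryIndex i r u)) (root-column i u) ⟩
      T (queryIndex i (root ⟪ i , 0 ⟫) u)
        ∎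
      where open ≡-Reasoning

  components-computes : Computes (searchCode rootTest rootAnswer) T components
  components-computes = proj₂ (proj₂ search)

  components-solution : Sol (parallel P) X components
  components-solution i =
    IsComponent-fromRoot (graphs i) (proj₁ (root-least i 0)) (components-member i)

parallelP≤sWparallelLPO : parallel P ≤sW parallel LPO
parallelP≤sWparallelLPO =
  boolCode `pathQueries , searchCode rootTest rootAnswer , λ X graphs →
  pathQueries X , pathQueries-computes X , pathQueries-isInstance X ,
  λ T sT → let open ComponentsFromAnswers X graphs T sT
           in components , components-computes , components-solution

IsDecomposition-fromLabel : ∀ {X T} (label : ℕ → ℕ) → IsGraph X →
  (∀ {v w} → Path X v w → label v ≡ label w) →
  (∀ {v w} → Vert X v → Vert X w → label v ≡ label w → Path X v w) →
  (∀ v n → T ⟪ v , n ⟫ ≡ true ⇔ (Vert X v × n ≡ label v)) →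
  IsDecomposition X T
IsDecomposition-fromLabel label G label-resp label-joins member =
  (λ v n h → proj₁ (to v n h)) ,
  (λ v vert → label v , from v (label v) (vert , refl)) ,
  (λ v n m h h′ → trans (proj₂ (to v n h)) (sym (proj₂ (to v m h′)))) ,
  λ v₀ v₁ n₀ n₁ h₀ h₁ →
    let (vert₀ , n₀≡) = to v₀ n₀ h₀
        (vert₁ , n₁≡) = to v₁ n₁ h₁
    in mk⇔ (λ n₀≡n₁ → label-joins vert₀ vert₁ (trans (sym n₀≡) (trans n₀≡n₁ n₁≡)))
           (λ p → trans n₀≡ (trans (label-resp p) (sym n₁≡)))
  where
  to   = λ v n → Equivalence.to (member v n)
  from = λ v n → Equivalence.from (member v n)

-- on input ⟪ i , ⟪ v , n ⟫ ⟫, answer whether v is a vertex of graph i labelled by the least vertex connected to it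
`decomposition : Exp 1
`decomposition = `query i v v `∧ n `≡ `firstBelow (`n 1 `+ v) (`query i↑ (`v (# 0)) v↑)
  where
  z  = `v (# 0)
  i  = `unpair₁ z
  v  = `unpair₁ (`unpair₂ z)
  n  = `unpair₂ (`unpair₂ z)
  i↑ = `unpair₁ (`v (# 2))
  v↑ = `unpair₁ (`unpair₂ (`v (# 2)))

module DecompositionFromAnswers (X T : Cantor) (sT : Sol (parallel LPO) (pathQueries X) T) where
  open PathAnswers X T sT

  label : ℕ → ℕ → ℕ
  label i v = firstBelow (λ u → bit (T (queryIndex i u v))) (suc v)

  decompositionᴺ : ℕ → ℕ
  decompositionᴺ z = bit (T (queryIndex i v v)) ∧ᴺ n ≡ᴺ label i v
    where
    i = unpair₁ z
    v = unpair₁ (unpair₂ z)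
    n = unpair₂ (unpair₂ z)

  decomposition : Cantor
  decomposition z = toBool (decompositionᴺ z)

  decomposition-computes : Computes (boolCode `decomposition) T decomposition
  decomposition-computes = boolCode-computes T `decomposition

  decompositionᴺ-pair : ∀ i v n → decompositionᴺ ⟪ i , ⟪ v , n ⟫ ⟫ ≡ (bit (T (queryIndex i v v)) ∧ᴺ n ≡ᴺ label i v)
  decompositionᴺ-pair i v n
    rewrite unpair₁-pair i ⟪ v , n ⟫ | unpair₂-pair i ⟪ v , n ⟫ | unpair₁-pair v n | unpair₂-pair v n = refl

  module _ (i : ℕ) (G : IsGraph (column X i)) where

    label-least : ∀ {v} → Vert (column X i) v → Least (λ u → Path (column X i) u v) (label i v)
    label-least {v} vert = firstBelow-least (λ u → bit (T (queryIndex i u v))) (λ u → answer-reflects i u v) (p-nil vert)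

    label-resp : ∀ {v w} → Path (column X i) v w → label i v ≡ label i w
    label-resp {v} {w} p =
      Least-unique {Q₀ = λ u → Path (column X i) u v} {Q₁ = λ u → Path (column X i) u w}
                   (λ _ q → Path-trans q p) (λ _ q → Path-trans q (Path-sym G p))
                   (label-least (Path-vertexˡ G p)) (label-least (Path-vertexʳ G p))

    label-joins : ∀ {v w} → Vert (column X i) v → Vert (column X i) w → label i v ≡ label i w → Path (column X i) v w
    label-joins {v} {w} vert-v vert-w e =
      Path-trans (Path-sym G (proj₁ (label-least vert-v)))
                 (subst (λ u → Path (column X i) u w) (sym e) (proj₁ (label-least vert-w)))

    decomposition-member : ∀ v n → column decomposition i ⟪ v , n ⟫ ≡ true ⇔ (Vert (column X i) v × n ≡ label i v)
    decomposition-member v n =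
      subst (λ b → toBool b ≡ true ⇔ (Vert (column X i) v × n ≡ label i v)) (sym (decompositionᴺ-pair i v n))
            (toBool-reflects (∧ᴺ-reflects (Reflectsᴺ-map (Path-vertexˡ G) p-nil (answer-reflects i v v))
                                          (≡ᴺ-reflects n (label i v))))

    decomposition-solution : IsDecomposition (column X i) (column decomposition i)
    decomposition-solution =
      IsDecomposition-fromLabel {T = column decomposition i} (label i) G label-resp label-joins decomposition-member

parallelD≤sWparallelLPO : parallel D ≤sW parallel LPO
parallelD≤sWparallelLPO = boolCode `pathQueries , boolCode `decomposition , λ X graphs →
  pathQueries X , pathQueries-computes X , pathQueries-isInstance X ,
  λ T sT → let open DecompositionFromAnswers X T sT
           in decomposition , decomposition-computes , λ i → decomposition-solution i (graphs i)

theorem6p4 : (P ≡sW parallel LPO) × (parallel P ≡sW parallel LPO) × (D ≡sW parallel LPO) × (parallel D ≡sW parallel LPO)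
theorem6p4 =
  (P≤sWparallelLPO , parallelLPO≤sWP) ,
  (parallelP≤sWparallelLPO , ≤sW-trans parallelLPO≤sWP (≤sW-parallel P P-extensional)) ,
  (D≤sWparallelLPO , parallelLPO≤sWD) ,
  (parallelD≤sWparallelLPO , ≤sW-trans parallelLPO≤sWD (≤sW-parallel D D-extensional))
  where
  P≤sWparallelLPO : P ≤sW parallel LPO
  P≤sWparallelLPO = ≤sW-trans (≤sW-parallel P P-extensional) parallelP≤sWparallelLPO
  D≤sWparallelLPO : D ≤sW parallel LPO
  D≤sWparallelLPO = ≤sW-trans (≤sW-parallel D D-extensional) parallelD≤sWparallelLPO
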